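{- Let $s,t$ be variables and define polynomials $F_n$ by $F_0=0$, $F_1=1$, $F_n=sF_{n-1}+tF_{n-2}$ ($n\ge2$), and let $\left\{\begin{matrix} n\\ k\end{matrix}\right\}=\frac{F_n!}{F_k!F_{n-k}!}$ for $0\le k\le n$, where $F_n!=F_1F_2\cdots F_n$ and $F_0!=1$. Then for all integers $m,n\ge 0$, $$\left\{\begin{matrix} m+n\\ m\end{matrix}\right\}=\sum_{\lambda\subseteq m\times n}\ \sum_{T\in\mathcal{L}_\lambda\times\mathcal{L}'_{\lambda^*}} w(T)$$ and $$2^{m+n}\left\{\begin{matrix} m+n\\ m\end{matrix}\right\}=\sum_{\lambda\subseteq m\times n}\ \sum_{T\in\mathcal{C}_\lambda\times\mathcal{C}_{\lambda^*}} w(T),$$ where in the first identity the weights are linear weights and in the second they are circular weights (as defined in the context).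
   Context: A partition $\lambda=(\lambda_1,\dots,\lambda_m)$ is a weakly decreasing sequence of nonnegative integers (zero parts allowed). We write $\lambda\subseteq m\times n$ if $\lambda$ has exactly $m$ parts each at most $n$; its Ferrers diagram consists of $m$ left-justified rows with $\lambda_i$ boxes in row $i$, sitting inside an $m\times n$ rectangle. Then $\lambda^*=(\lambda^*_1,\dots,\lambda^*_n)$ is the partition (with $n$ parts, zeros allowed) whose parts are the lengths of the columns of the complement of $\lambda$ in the $m\times n$ rectangle. A linear tiling of a $1\times \ell$ row of $\ell$ squares is a covering by disjoint monominos (covering one square) and dominos (covering two adjacent squares); $\mathcal{L}_\ell$ is the set of these (for $\ell=0$ it consists of the empty tiling). $\mathcal{L}'_\ell\subseteq\mathcal{L}_\ell$ is the set of linear tilings not beginning with a monomino (so $\mathcal{L}'_0=\{\text{empty tiling}\}$, $\mathcal{L}'_1=\emptyset$). A circular tiling of a $1\times\ell$ row is like a linear tiling except that the left edge of the first square and right edge of the last square are identified, so a domino may also cover the last and first squares together; $\mathcal{C}_\ell$ is the set of these. For a sequence $\mu=(\mu_1,\dots,\mu_r)$ of nonnegative integers, $\mathcal{L}_\mu=\mathcal{L}_{\mu_1}\times\cdots\times\mathcal{L}_{\mu_r}$, and similarly $\mathcal{L}'_\mu$, $\mathcal{C}_\mu$; thus an element of $\mathcal{L}_\lambda$ tiles each row of $\lambda$ and an element of $\mathcal{L}'_{\lambda^*}$ (or $\mathcal{C}_{\lambda^*}$) tiles each column of the complement. Weights: a tiling of a single row with $a$ monominos and $b$ dominos has weight $s^a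 t^b$, except that in the circular setting the empty tiling (of a row of length $0$) has weight $2$, while in the linear setting the empty tiling has weight $1$. The weight $w(T)$ of a tuple of tilings is the product of the weights of its components. -}

module Defs where

open import Level using (Level)
open import Algebra.Bundles using (CommutativeSemiring)
open import Data.Nat as ℕ using (ℕ; zero; suc; _≤ᵇ_; _∸_)
open import Data.Bool using (Bool; true; false; _∧_; if_then_else_)
open import Data.List as List using (List; []; _∷_; concatMap; map; filterᵇ; upTo; cartesianProduct)
open import Data.List.Relation.Unary.All using (All; []; _∷_)
open import Data.Vec as Vec using (Vec; []; _∷_; tabulate; toList)
open import Data.Fin using (Fin; toℕ)
open import Data.Product using (_×_; _,_)

data LTiling : ℕ → Set where
  empty : LTiling zero
  mono  : ∀ {ℓ} → LTiling ℓ → LTiling (suc ℓ)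
  dom   : ∀ {ℓ} → LTiling ℓ → LTiling (suc (suc ℓ))

-- Circular tilings of a 1×ℓ row: either no domino crosses the identified
-- edge (a linear tiling of the row), or a domino covers the last and the
-- first square and the remaining ℓ-2 middle squares are tiled linearly.
data CTiling : ℕ → Set where
  lin  : ∀ {ℓ} → LTiling ℓ → CTiling ℓ
  wrap : ∀ {ℓ} → LTiling ℓ → CTiling (suc (suc ℓ))

allL : (ℓ : ℕ) → List (LTiling ℓ)
allL zero = empty ∷ []
allL (suc zero) = mono empty ∷ []
allL (suc (suc ℓ)) = map mono (allL (suc ℓ)) List.++ map dom (allL ℓ)

startsMono : ∀ {ℓ} → LTiling ℓ → Bool
startsMono empty = false
startsMono (mono _) = true
startsMono (dom _) = false

notB : Bool → Bool
notB true = false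
notB false = true

allL' : (ℓ : ℕ) → List (LTiling ℓ)
allL' ℓ = filterᵇ (λ T → notB (startsMono T)) (allL ℓ)

allC : (ℓ : ℕ) → List (CTiling ℓ)
allC zero = map lin (allL zero)
allC (suc zero) = map lin (allL (suc zero))
allC (suc (suc ℓ)) = map lin (allL (suc (suc ℓ))) List.++ map wrap (allL ℓ)

allTuples : {A : ℕ → Set} → ((ℓ : ℕ) → List (A ℓ)) → (μ : List ℕ) → List (All A μ)
allTuples f [] = [] ∷ []
allTuples f (ℓ ∷ μ) = concatMap (λ T → map (T ∷_) (allTuples f μ)) (f ℓ)

allVecs : (m : ℕ) → List ℕ → List (Vec ℕ m)
allVecs zero xs = [] ∷ []
allVecs (suc m) xs = concatMap (λ x → map (x ∷_) (allVecs m xs)) xs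

weaklyDecreasing : ∀ {m} → Vec ℕ m → Bool
weaklyDecreasing [] = true
weaklyDecreasing (x ∷ []) = true
weaklyDecreasing (x ∷ y ∷ v) = (y ≤ᵇ x) ∧ weaklyDecreasing (y ∷ v)

-- All partitions λ ⊆ m × n : exactly m (possibly zero) weakly decreasing
-- parts, each at most n.
partitionsIn : (m n : ℕ) → List (Vec ℕ m)
partitionsIn m n = filterᵇ weaklyDecreasing (allVecs m (upTo (suc n)))

countB : ∀ {m} → (ℕ → Bool) → Vec ℕ m → ℕ
countB p [] = zero
countB p (x ∷ v) = if p x then suc (countB p v) else countB p v

-- λ* : the n column lengths of the complement of λ in the m × n rectangle,
-- in weakly decreasing order.  The k-th part (k = 1..n, here index k-1)
-- is the length of column n+1-k of the complement,
-- i.e. #{ i | λ_i < n+1-k } = #{ i | λ_i ≤ n - k }.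
dual : ∀ {m} (n : ℕ) → Vec ℕ m → Vec ℕ n
dual n λ′ = tabulate (λ (k : Fin n) → countB (λ x → x ≤ᵇ (n ∸ suc (toℕ k))) λ′)

-- Weights, Fibonacci polynomials, fibonomials: in any commutative
-- semiring R, with s t ∈ R (the universal case is R = ℕ[s,t]).

module WithRing {c ℓ : Level} (R : CommutativeSemiring c ℓ) (s t : CommutativeSemiring.Carrier R) where
  open CommutativeSemiring R

  sumR : List Carrier → Carrier
  sumR = List.foldr _+_ 0#

  two : Carrier
  two = 1# + 1#

  pow : Carrier → ℕ → Carrier
  pow x zero = 1#
  pow x (suc k) = x * pow x k

  wL : ∀ {n} → LTiling n → Carrier
  wL empty = 1#
  wL (mono T) = s * wL T
  wL (dom T) = t * wL T

  wC : ∀ {n} → CTiling n → Carrier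
  wC {zero} (lin T) = two
  wC {suc _} (lin T) = wL T
  wC (wrap T) = t * wL T

  wTuple : {A : ℕ → Set} → (∀ {n} → A n → Carrier) → ∀ {μ} → All A μ → Carrier
  wTuple w [] = 1#
  wTuple w (T ∷ Ts) = w T * wTuple w Ts

  F : ℕ → Carrier
  F zero = 0#
  F (suc zero) = 1#
  F (suc (suc n)) = s * F (suc n) + t * F n

  F! : ℕ → Carrier
  F! zero = 1#
  F! (suc n) = F! n * F (suc n)

  linearSum : ℕ → ℕ → Carrier
  linearSum m n =
    sumR (concatMap
      (λ λ′ → map (λ { (T , U) → wTuple wL T * wTuple wL U })
                  (cartesianProduct (allTuples allL (toList λ′))
                                    (allTuples allL' (toList (dual n λ′)))))
      (partitionsIn m n))

  circularSum : ℕ → ℕ → Carrier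
  circularSum m n =
    sumR (concatMap
      (λ λ′ → map (λ { (T , U) → wTuple wC T * wTuple wC U })
                  (cartesianProduct (allTuples allC (toList λ′))
                                    (allTuples allC (toList (dual n λ′)))))
      (partitionsIn m n))

-- Both sums factor over the rows and columns of λ: a row of length ℓ contributes the total
-- weight f ℓ of its tilings and a complement column of length ℓ contributes g ℓ.  Splitting off
-- the largest part of λ shows that Z(m,n) = Σ_λ Π f(λ_i) Π g(λ*_j) satisfies the Pascal rule
-- Z(m+1,n+1) = f(n+1) Z(m,n+1) + g(m+1) Z(m+1,n) with Z(0,n) = g(0)^n and Z(m,0) = f(0)^m.
-- Linearly f ℓ = F_{ℓ+1} and g (ℓ+1) = t F_ℓ; circularly f = g is the Lucas polynomial.
-- By the addition formula F_{m+n+1} = F_{m+1} F_{n+1} + t F_m F_n, the fibonomials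
-- (times 2^{m+n} in the circular case) obey the same rule with the same boundary values.
module Submission where

open import Defs
open import Level using (Level)
open import Algebra.Bundles using (CommutativeSemiring)
open import Data.Nat using (ℕ) renaming (_+_ to _+ℕ_)
open import Data.Product using (_×_)
open CommutativeSemiring using (Carrier; _≈_; _*_)
open WithRing using (F!; linearSum; circularSum; pow; two)

open import Data.Bool using (Bool; true; false; _∧_; if_then_else_)
open import Data.Empty using (⊥-elim)
open import Data.List using (List; []; _∷_; _++_; map; foldr; concatMap; filterᵇ; upTo; replicate; cartesianProduct)
import Data.List.Properties as List
open import Data.List.Relation.Unary.All as All using (All; []; _∷_)
open import Data.Nat using (zero; suc; _≤_; _<_; _≤ᵇ_; _∸_; s≤s)
import Data.Nat.Properties as ℕ
open import Data.Nat.Properties using (≤-refl; ≤-trans; ≤-pred; <⇒≱; m<n⇒m<1+n; n<1+n; m≤n⇒m<n∨m≡n; ≤ᵇ-reflects-≤)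
open import Data.Product using (_,_)
open import Data.Sum using (inj₁; inj₂)
open import Data.Vec using (Vec; []; _∷_; toList)
open import Function using (_∘_)
open import Relation.Binary.PropositionalEquality as ≡ using (_≡_; refl; cong)
open import Relation.Nullary.Reflects using (ofʸ; ofⁿ)

≤ᵇ-true : ∀ {a b} → a ≤ b → (a ≤ᵇ b) ≡ true
≤ᵇ-true {a} {b} a≤b with a ≤ᵇ b | ≤ᵇ-reflects-≤ a b
... | true  | _       = refl
... | false | ofⁿ a≰b = ⊥-elim (a≰b a≤b)

≤ᵇ-false : ∀ {a b} → b < a → (a ≤ᵇ b) ≡ false
≤ᵇ-false {a} {b} b<a with a ≤ᵇ b | ≤ᵇ-reflects-≤ a b
... | false | _       = refl
... | true  | ofʸ a≤b = ⊥-elim (<⇒≱ b<a a≤b)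

countB-all : ∀ {m} {p : ℕ → Bool} (v : Vec ℕ m) → All (λ x → p x ≡ true) (toList v) → countB p v ≡ m
countB-all []      []         = refl
countB-all (x ∷ v) (px ∷ pv) rewrite px = cong suc (countB-all v pv)

weaklyDecreasing-head : ∀ {m} z (v : Vec ℕ m) → weaklyDecreasing (z ∷ v) ≡ true → All (_≤ z) (toList v)
weaklyDecreasing-head z []      _ = []
weaklyDecreasing-head z (y ∷ v) decreasing with y ≤ᵇ z | ≤ᵇ-reflects-≤ y z
... | true | ofʸ y≤z = y≤z ∷ All.map (λ x≤y → ≤-trans x≤y y≤z) (weaklyDecreasing-head y v decreasing)

dual-[] : ∀ n → toList (dual n []) ≡ replicate n 0
dual-[] zero    = refl
dual-[] (suc n) = cong (0 ∷_) (dual-[] n)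

dual-cons-≥ : ∀ {m} k z (v : Vec ℕ m) → k ≤ z → toList (dual k (z ∷ v)) ≡ toList (dual k v)
dual-cons-≥ zero    z v _   = refl
dual-cons-≥ (suc k) z v k<z rewrite ≤ᵇ-false {z} {k} k<z =
  cong (countB (_≤ᵇ k) v ∷_) (dual-cons-≥ k z v (ℕ.<⇒≤ k<z))

-- dual n lists the complement columns from right to left, so a new largest part z fills
-- the n ∸ z rightmost columns completely and leaves the others unchanged.
dual-cons : ∀ {m} n z (v : Vec ℕ m) → All (_≤ z) (toList v) → z ≤ n →
  toList (dual n (z ∷ v)) ≡ replicate (n ∸ z) (suc m) ++ toList (dual z v)
dual-cons zero zero    v _ _  = refl
dual-cons zero (suc z) v _ ()
dual-cons {m} (suc n) z v bounded z≤1+n with m≤n⇒m<n∨m≡n z≤1+n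
... | inj₂ refl rewrite ℕ.n∸n≡0 n = dual-cons-≥ (suc n) (suc n) v ≤-refl
... | inj₁ z<1+n = begin
  countB (_≤ᵇ n) (z ∷ v) ∷ toList (dual n (z ∷ v))
    ≡⟨ ≡.cong₂ _∷_ (countB-all (z ∷ v) (All.map ≤ᵇ-true (z≤n′ ∷ All.map (λ x≤z → ≤-trans x≤z z≤n′) bounded)))
                   (dual-cons n z v bounded z≤n′) ⟩
  suc m ∷ replicate (n ∸ z) (suc m) ++ toList (dual z v)
    ≡⟨ cong (λ k → replicate k (suc m) ++ toList (dual z v)) (≡.sym (ℕ.+-∸-assoc 1 z≤n′)) ⟩
  replicate (suc n ∸ z) (suc m) ++ toList (dual z v) ∎
  where
    open ≡.≡-Reasoning
    z≤n′ : z ≤ n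
    z≤n′ = ≤-pred z<1+n

module _ {c ℓ : Level} (R : CommutativeSemiring c ℓ) where
  open CommutativeSemiring R hiding (zero)
    renaming (Carrier to C; _≈_ to _≋_; _*_ to _·_; refl to ≋-refl)
  open import Algebra.Properties.Semiring.Exp semiring using (_^_; ^-congˡ)
  open import Algebra.Solver.Ring.NaturalCoefficients.Default R
  open import Relation.Binary.Reasoning.Setoid setoid

  ∑ : List C → C
  ∑ = foldr _+_ 0#

  ∑-++ : ∀ xs ys → ∑ (xs ++ ys) ≋ ∑ xs + ∑ ys
  ∑-++ []       ys = sym (+-identityˡ _)
  ∑-++ (x ∷ xs) ys = trans (+-congˡ (∑-++ xs ys)) (sym (+-assoc _ _ _))

  ∑-map-++ : ∀ {X : Set} (h : X → C) xs ys → ∑ (map h (xs ++ ys)) ≋ ∑ (map h xs) + ∑ (map h ys)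
  ∑-map-++ h xs ys = trans (reflexive (cong ∑ (List.map-++ h xs ys))) (∑-++ (map h xs) (map h ys))

  ∑-map-cong : ∀ {X : Set} {f g : X → C} → (∀ x → f x ≋ g x) → ∀ xs → ∑ (map f xs) ≋ ∑ (map g xs)
  ∑-map-cong f≋g []       = ≋-refl
  ∑-map-cong f≋g (x ∷ xs) = +-cong (f≋g x) (∑-map-cong f≋g xs)

  ∑-map-∘ : ∀ {X Y : Set} (f : Y → C) (g : X → Y) xs → ∑ (map f (map g xs)) ≋ ∑ (map (f ∘ g) xs)
  ∑-map-∘ f g xs = reflexive (cong ∑ (≡.sym (List.map-∘ xs)))

  ∑-concatMap : ∀ {X : Set} (k : X → List C) xs → ∑ (concatMap k xs) ≋ ∑ (map (∑ ∘ k) xs)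
  ∑-concatMap k []       = ≋-refl
  ∑-concatMap k (x ∷ xs) = trans (∑-++ (k x) _) (+-congˡ (∑-concatMap k xs))

  ∑-map-concatMap : ∀ {X Y : Set} (h : Y → C) (k : X → List Y) xs →
    ∑ (map h (concatMap k xs)) ≋ ∑ (map (λ x → ∑ (map h (k x))) xs)
  ∑-map-concatMap h k xs = trans (reflexive (cong ∑ (List.map-concatMap h k xs))) (∑-concatMap _ xs)

  ∑-map-*ˡ : ∀ {X : Set} a (f : X → C) xs → ∑ (map (λ x → a · f x) xs) ≋ a · ∑ (map f xs)
  ∑-map-*ˡ a f []       = sym (zeroʳ a)
  ∑-map-*ˡ a f (x ∷ xs) = trans (+-congˡ (∑-map-*ˡ a f xs)) (sym (distribˡ a _ _))

  ∑-map-*ʳ : ∀ {X : Set} a (f : X → C) xs → ∑ (map (λ x → f x · a) xs) ≋ ∑ (map f xs) · a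
  ∑-map-*ʳ a f []       = sym (zeroˡ a)
  ∑-map-*ʳ a f (x ∷ xs) = trans (+-congˡ (∑-map-*ʳ a f xs)) (sym (distribʳ a _ _))

  ∑-map-0 : ∀ {X : Set} (xs : List X) → ∑ (map (λ _ → 0#) xs) ≋ 0#
  ∑-map-0 []       = ≋-refl
  ∑-map-0 (x ∷ xs) = trans (+-identityˡ _) (∑-map-0 xs)

  ∑-cartesianProduct : ∀ {X Y : Set} {h : X × Y → C} (f : X → C) (g : Y → C) →
    (∀ x y → h (x , y) ≋ f x · g y) →
    ∀ xs ys → ∑ (map h (cartesianProduct xs ys)) ≋ ∑ (map f xs) · ∑ (map g ys)
  ∑-cartesianProduct f g h≋ []       ys = sym (zeroˡ _)
  ∑-cartesianProduct {h = h} f g h≋ (x ∷ xs) ys = begin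
    ∑ (map h (map (x ,_) ys ++ cartesianProduct xs ys))
      ≈⟨ ∑-map-++ h (map (x ,_) ys) _ ⟩
    ∑ (map h (map (x ,_) ys)) + ∑ (map h (cartesianProduct xs ys))
      ≈⟨ +-cong (trans (∑-map-∘ h (x ,_) ys) (trans (∑-map-cong (h≋ x) ys) (∑-map-*ˡ (f x) g ys)))
                (∑-cartesianProduct f g h≋ xs ys) ⟩
    f x · ∑ (map g ys) + ∑ (map f xs) · ∑ (map g ys)
      ≈⟨ sym (distribʳ _ _ _) ⟩
    (f x + ∑ (map f xs)) · ∑ (map g ys) ∎

  when : Bool → C → C
  when b x = if b then x else 0#

  when-cong : ∀ b {x y} → (b ≡ true → x ≋ y) → when b x ≋ when b y
  when-cong true  x≋y = x≋y refl
  when-cong false x≋y = ≋-refl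

  when-*ˡ : ∀ b a x → when b (a · x) ≋ a · when b x
  when-*ˡ true  a x = ≋-refl
  when-*ˡ false a x = sym (zeroʳ a)

  when-∧ : ∀ a b x → when (a ∧ b) x ≡ when a (when b x)
  when-∧ true  b x = refl
  when-∧ false b x = refl

  ∑-map-when : ∀ {X : Set} b (f : X → C) xs → ∑ (map (λ x → when b (f x)) xs) ≋ when b (∑ (map f xs))
  ∑-map-when true  f xs = ≋-refl
  ∑-map-when false f xs = ∑-map-0 xs

  ∑-filterᵇ : ∀ {X : Set} (p : X → Bool) (h : X → C) xs →
    ∑ (map h (filterᵇ p xs)) ≋ ∑ (map (λ x → when (p x) (h x)) xs)
  ∑-filterᵇ p h []       = ≋-refl
  ∑-filterᵇ p h (x ∷ xs) with p x
  ... | true  = +-congˡ (∑-filterᵇ p h xs)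
  ... | false = trans (∑-filterᵇ p h xs) (sym (+-identityˡ _))

  ∑< : ℕ → (ℕ → C) → C
  ∑< zero    K = 0#
  ∑< (suc N) K = ∑< N K + K N

  ∑-map-upTo : ∀ N K → ∑ (map K (upTo N)) ≋ ∑< N K
  ∑-map-upTo zero    K = ≋-refl
  ∑-map-upTo (suc N) K = begin
    ∑ (map K (upTo (suc N)))         ≡⟨ cong (∑ ∘ map K) (≡.sym (List.upTo-∷ʳ N)) ⟩
    ∑ (map K (upTo N ++ (N ∷ [])))   ≈⟨ ∑-map-++ K (upTo N) (N ∷ []) ⟩
    ∑ (map K (upTo N)) + (K N + 0#)  ≈⟨ +-cong (∑-map-upTo N K) (+-identityʳ _) ⟩
    ∑< N K + K N                     ∎

  ∑<-cong : ∀ N {K K′ : ℕ → C} → (∀ z → z < N → K z ≋ K′ z) → ∑< N K ≋ ∑< N K′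
  ∑<-cong zero    K≋K′ = ≋-refl
  ∑<-cong (suc N) K≋K′ = +-cong (∑<-cong N (λ z z<N → K≋K′ z (m<n⇒m<1+n z<N))) (K≋K′ N (n<1+n N))

  ∑<-*ˡ : ∀ N a (K : ℕ → C) → ∑< N (λ z → a · K z) ≋ a · ∑< N K
  ∑<-*ˡ zero    a K = sym (zeroʳ a)
  ∑<-*ˡ (suc N) a K = trans (+-congʳ (∑<-*ˡ N a K)) (sym (distribˡ a _ _))

  ∑<-when-≤ : ∀ z n (K : ℕ → C) → z ≤ n → ∑< (suc n) (λ y → when (y ≤ᵇ z) (K y)) ≋ ∑< (suc z) K
  ∑<-when-≤ z n K z≤n′ with m≤n⇒m<n∨m≡n z≤n′
  ... | inj₂ refl = ∑<-cong (suc z) (λ y y≤z → reflexive (cong (λ b → when b (K y)) (≤ᵇ-true (≤-pred y≤z))))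
  ∑<-when-≤ z (suc n) K _ | inj₁ (s≤s z≤n′) rewrite ≤ᵇ-false {suc n} {z} (s≤s z≤n′) =
    trans (+-identityʳ _) (∑<-when-≤ z n K z≤n′)

  ∏ : (ℕ → C) → List ℕ → C
  ∏ w []      = 1#
  ∏ w (x ∷ μ) = w x · ∏ w μ

  ∏-++ : ∀ w μ ν → ∏ w (μ ++ ν) ≋ ∏ w μ · ∏ w ν
  ∏-++ w []      ν = sym (*-identityˡ _)
  ∏-++ w (x ∷ μ) ν = trans (*-congˡ (∏-++ w μ ν)) (sym (*-assoc _ _ _))

  ∏-replicate : ∀ w k x → ∏ w (replicate k x) ≋ w x ^ k
  ∏-replicate w zero    x = ≋-refl
  ∏-replicate w (suc k) x = *-congˡ (∏-replicate w k x)

  ^-zeroˡ : ∀ n → 1# ^ n ≋ 1#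
  ^-zeroˡ zero    = ≋-refl
  ^-zeroˡ (suc n) = trans (*-identityˡ _) (^-zeroˡ n)

  ∑-allVecs-suc : ∀ m xs (h : Vec ℕ (suc m) → C) →
    ∑ (map h (allVecs (suc m) xs)) ≋ ∑ (map (λ y → ∑ (map (λ u → h (y ∷ u)) (allVecs m xs))) xs)
  ∑-allVecs-suc m xs h = trans (∑-map-concatMap h (λ y → map (y ∷_) (allVecs m xs)) xs)
                               (∑-map-cong (λ y → ∑-map-∘ h (y ∷_) (allVecs m xs)) xs)

  -- A decreasing vector headed by z is z followed by a decreasing vector with entries ≤ z.
  ∑-decreasingTails : ∀ m {n} z (h : Vec ℕ m → C) → z ≤ n →
    ∑ (map (λ v → when (weaklyDecreasing (z ∷ v)) (h v)) (allVecs m (upTo (suc n)))) ≋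
    ∑ (map (λ v → when (weaklyDecreasing v) (h v)) (allVecs m (upTo (suc z))))
  ∑-decreasingTails zero    z h z≤n′ = ≋-refl
  ∑-decreasingTails (suc m) {n} z h z≤n′ = begin
    ∑ (map (λ v → when (weaklyDecreasing (z ∷ v)) (h v)) (allVecs (suc m) (upTo (suc n))))
      ≈⟨ ∑-allVecs-suc m (upTo (suc n)) _ ⟩
    ∑ (map (λ y → ∑ (map (λ u → when (weaklyDecreasing (z ∷ y ∷ u)) (h (y ∷ u))) (allVecs m (upTo (suc n)))))
           (upTo (suc n)))
      ≈⟨ ∑-map-upTo (suc n) _ ⟩
    ∑< (suc n) (λ y → ∑ (map (λ u → when (weaklyDecreasing (z ∷ y ∷ u)) (h (y ∷ u))) (allVecs m (upTo (suc n)))))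
      ≈⟨ ∑<-cong (suc n) (λ y y≤n → headedBelow-z y (≤-pred y≤n)) ⟩
    ∑< (suc n) (λ y → when (y ≤ᵇ z) (decreasingTails y))
      ≈⟨ ∑<-when-≤ z n decreasingTails z≤n′ ⟩
    ∑< (suc z) decreasingTails
      ≈⟨ ∑<-cong (suc z) (λ y y≤z → sym (∑-decreasingTails m y (h ∘ (y ∷_)) (≤-pred y≤z))) ⟩
    ∑< (suc z) (λ y → ∑ (map (λ u → when (weaklyDecreasing (y ∷ u)) (h (y ∷ u))) (allVecs m (upTo (suc z)))))
      ≈⟨ sym (∑-map-upTo (suc z) _) ⟩
    ∑ (map (λ y → ∑ (map (λ u → when (weaklyDecreasing (y ∷ u)) (h (y ∷ u))) (allVecs m (upTo (suc z)))))
           (upTo (suc z)))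
      ≈⟨ sym (∑-allVecs-suc m (upTo (suc z)) _) ⟩
    ∑ (map (λ v → when (weaklyDecreasing v) (h v)) (allVecs (suc m) (upTo (suc z)))) ∎
    where
      decreasingTails : ℕ → C
      decreasingTails y = ∑ (map (λ u → when (weaklyDecreasing u) (h (y ∷ u))) (allVecs m (upTo (suc y))))

      headedBelow-z : ∀ y → y ≤ n →
        ∑ (map (λ u → when (weaklyDecreasing (z ∷ y ∷ u)) (h (y ∷ u))) (allVecs m (upTo (suc n)))) ≋
        when (y ≤ᵇ z) (decreasingTails y)
      headedBelow-z y y≤n = begin
        ∑ (map (λ u → when (weaklyDecreasing (z ∷ y ∷ u)) (h (y ∷ u))) (allVecs m (upTo (suc n))))
          ≡⟨ cong ∑ (List.map-cong (λ u → when-∧ (y ≤ᵇ z) _ (h (y ∷ u))) (allVecs m (upTo (suc n)))) ⟩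
        ∑ (map (λ u → when (y ≤ᵇ z) (when (weaklyDecreasing (y ∷ u)) (h (y ∷ u)))) (allVecs m (upTo (suc n))))
          ≈⟨ ∑-map-when (y ≤ᵇ z) _ (allVecs m (upTo (suc n))) ⟩
        when (y ≤ᵇ z) (∑ (map (λ u → when (weaklyDecreasing (y ∷ u)) (h (y ∷ u))) (allVecs m (upTo (suc n)))))
          ≈⟨ when-cong (y ≤ᵇ z) (λ _ → ∑-decreasingTails m y (h ∘ (y ∷_)) y≤n) ⟩
        when (y ≤ᵇ z) (decreasingTails y) ∎

  totalWeight : ∀ {A : ℕ → Set} → (∀ ℓ → List (A ℓ)) → (∀ {ℓ} → A ℓ → C) → ℕ → C
  totalWeight tilings w ℓ = ∑ (map w (tilings ℓ))

  rowWeight : ∀ {m} → (ℕ → C) → Vec ℕ m → C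
  rowWeight f v = ∏ f (toList v)

  colWeight : ∀ {m} → (ℕ → C) → ℕ → Vec ℕ m → C
  colWeight g n v = ∏ g (toList (dual n v))

  colWeight-cons : ∀ {m} g n z (v : Vec ℕ m) → All (_≤ z) (toList v) → z ≤ n →
    colWeight g n (z ∷ v) ≋ g (suc m) ^ (n ∸ z) · colWeight g z v
  colWeight-cons {m} g n z v bounded z≤n′ = begin
    ∏ g (toList (dual n (z ∷ v)))                          ≡⟨ cong (∏ g) (dual-cons n z v bounded z≤n′) ⟩
    ∏ g (replicate (n ∸ z) (suc m) ++ toList (dual z v))   ≈⟨ ∏-++ g (replicate (n ∸ z) (suc m)) (toList (dual z v)) ⟩
    ∏ g (replicate (n ∸ z) (suc m)) · colWeight g z v       ≈⟨ *-congʳ (∏-replicate g (n ∸ z) (suc m)) ⟩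
    g (suc m) ^ (n ∸ z) · colWeight g z v                   ∎

  colWeight-[] : ∀ g n → colWeight g n [] ≋ g 0 ^ n
  colWeight-[] g n = trans (reflexive (cong (∏ g) (dual-[] n))) (∏-replicate g n 0)

  module _ (f g : ℕ → C) where
    partitionSum : ℕ → ℕ → C
    partitionSum m n = ∑ (map (λ v → rowWeight f v · colWeight g n v) (partitionsIn m n))

    -- Splitting off the largest part z: the remaining rows form a partition inside m × z,
    -- and the n ∸ z columns to the right of z have complements of full length m + 1.
    partitionSum-suc : ∀ m n →
      partitionSum (suc m) n ≋ ∑< (suc n) (λ z → (f z · g (suc m) ^ (n ∸ z)) · partitionSum m z)
    partitionSum-suc m n = begin
      partitionSum (suc m) n
        ≈⟨ ∑-filterᵇ weaklyDecreasing _ (allVecs (suc m) (upTo (suc n))) ⟩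
      ∑ (map (λ v → when (weaklyDecreasing v) (weight n v)) (allVecs (suc m) (upTo (suc n))))
        ≈⟨ ∑-allVecs-suc m (upTo (suc n)) _ ⟩
      ∑ (map headedBy (upTo (suc n)))
        ≈⟨ ∑-map-upTo (suc n) headedBy ⟩
      ∑< (suc n) headedBy
        ≈⟨ ∑<-cong (suc n) (λ z z≤n → headedBy-partitionSum z (≤-pred z≤n)) ⟩
      ∑< (suc n) (λ z → (f z · g (suc m) ^ (n ∸ z)) · partitionSum m z) ∎
      where
        weight : ∀ {k} → ℕ → Vec ℕ k → C
        weight n v = rowWeight f v · colWeight g n v

        headedBy : ℕ → C
        headedBy z = ∑ (map (λ u → when (weaklyDecreasing (z ∷ u)) (weight n (z ∷ u))) (allVecs m (upTo (suc n))))

        headedBy-partitionSum : ∀ z → z ≤ n → headedBy z ≋ (f z · g (suc m) ^ (n ∸ z)) · partitionSum m z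
        headedBy-partitionSum z z≤n′ = begin
          headedBy z
            ≈⟨ ∑-map-cong (λ u → when-cong (weaklyDecreasing (z ∷ u)) (split u)) (allVecs m (upTo (suc n))) ⟩
          ∑ (map (λ u → when (weaklyDecreasing (z ∷ u)) (a · weight z u)) (allVecs m (upTo (suc n))))
            ≈⟨ ∑-decreasingTails m z (λ u → a · weight z u) z≤n′ ⟩
          ∑ (map (λ u → when (weaklyDecreasing u) (a · weight z u)) (allVecs m (upTo (suc z))))
            ≈⟨ ∑-map-cong (λ u → when-*ˡ (weaklyDecreasing u) a (weight z u)) (allVecs m (upTo (suc z))) ⟩
          ∑ (map (λ u → a · when (weaklyDecreasing u) (weight z u)) (allVecs m (upTo (suc z))))
            ≈⟨ ∑-map-*ˡ a (λ u → when (weaklyDecreasing u) (weight z u)) (allVecs m (upTo (suc z))) ⟩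
          a · ∑ (map (λ u → when (weaklyDecreasing u) (weight z u)) (allVecs m (upTo (suc z))))
            ≈⟨ *-congˡ (sym (∑-filterᵇ weaklyDecreasing _ (allVecs m (upTo (suc z))))) ⟩
          a · partitionSum m z ∎
          where
            a : C
            a = f z · g (suc m) ^ (n ∸ z)

            split : ∀ u → weaklyDecreasing (z ∷ u) ≡ true → weight n (z ∷ u) ≋ a · weight z u
            split u decreasing = begin
              f z · rowWeight f u · colWeight g n (z ∷ u)
                ≈⟨ *-congˡ (colWeight-cons g n z u (weaklyDecreasing-head z u decreasing) z≤n′) ⟩
              f z · rowWeight f u · (g (suc m) ^ (n ∸ z) · colWeight g z u)
                ≈⟨ solve 4 (λ x y p w → x :* y :* (p :* w) := x :* p :* (y :* w)) ≋-refl
                     (f z) (rowWeight f u) (g (suc m) ^ (n ∸ z)) (colWeight g z u) ⟩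
              a · weight z u ∎

    partitionSum-zeroˡ : ∀ n → partitionSum 0 n ≋ g 0 ^ n
    partitionSum-zeroˡ n = trans (+-identityʳ _) (trans (*-identityˡ _) (colWeight-[] g n))

    partitionSum-zeroʳ : ∀ m → partitionSum m 0 ≋ f 0 ^ m
    partitionSum-zeroʳ zero    = partitionSum-zeroˡ 0
    partitionSum-zeroʳ (suc m) = trans (partitionSum-suc m 0)
      (trans (+-identityˡ _) (*-cong (*-identityʳ (f 0)) (partitionSum-zeroʳ m)))

    partitionSum-pascal : ∀ m n →
      partitionSum (suc m) (suc n) ≋ f (suc n) · partitionSum m (suc n) + g (suc m) · partitionSum (suc m) n
    partitionSum-pascal m n = begin
      partitionSum (suc m) (suc n)
        ≈⟨ partitionSum-suc m (suc n) ⟩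
      ∑< (suc n) (λ z → term (suc n) z) + term (suc n) (suc n)
        ≈⟨ +-cong (trans (∑<-cong (suc n) shift) (∑<-*ˡ (suc n) (g (suc m)) (term n))) last ⟩
      g (suc m) · ∑< (suc n) (term n) + f (suc n) · partitionSum m (suc n)
        ≈⟨ +-cong (*-congˡ (sym (partitionSum-suc m n))) ≋-refl ⟩
      g (suc m) · partitionSum (suc m) n + f (suc n) · partitionSum m (suc n)
        ≈⟨ +-comm _ _ ⟩
      f (suc n) · partitionSum m (suc n) + g (suc m) · partitionSum (suc m) n ∎
      where
        term : ℕ → ℕ → C
        term k z = (f z · g (suc m) ^ (k ∸ z)) · partitionSum m z

        shift : ∀ z → z < suc n → term (suc n) z ≋ g (suc m) · term n z
        shift z z<1+n rewrite ℕ.+-∸-assoc 1 (≤-pred z<1+n) =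
          solve 4 (λ x p y w → (x :* (p :* y)) :* w := p :* ((x :* y) :* w)) ≋-refl
            (f z) (g (suc m)) (g (suc m) ^ (n ∸ z)) (partitionSum m z)

        last : term (suc n) (suc n) ≋ f (suc n) · partitionSum m (suc n)
        last rewrite ℕ.n∸n≡0 n = *-congʳ (*-identityʳ _)

  module _ (s t : C) where
    open WithRing R s t using (F; wL; wC; wTuple) renaming (F! to _!)

    pow≈^ : ∀ x n → pow R s t x n ≋ x ^ n
    pow≈^ x zero    = ≋-refl
    pow≈^ x (suc n) = *-congˡ (pow≈^ x n)

    F-+ : ∀ k n → F (suc (k +ℕ n)) ≋ F (suc k) · F (suc n) + t · F k · F n
    F-+ zero          n = sym (trans (+-cong (*-identityˡ _) (trans (*-congʳ (zeroʳ t)) (zeroˡ _))) (+-identityʳ _))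
    F-+ (suc zero)    n = sym (+-cong (*-congʳ F₂) (*-congʳ (*-identityʳ t)))
      where
        F₂ : F 2 ≋ s
        F₂ = trans (+-cong (*-identityʳ s) (zeroʳ t)) (+-identityʳ s)
    F-+ (suc (suc k)) n = trans (+-cong (*-congˡ (F-+ (suc k) n)) (*-congˡ (F-+ k n)))
      (solve 6 (λ s t b c x y → s :* ((s :* b :+ t :* c) :* x :+ t :* b :* y) :+ t :* (b :* x :+ t :* c :* y)
                            := (s :* (s :* b :+ t :* c) :+ t :* b) :* x :+ t :* (s :* b :+ t :* c) :* y)
        ≋-refl s t (F (suc k)) (F k) (F (suc n)) (F n))

    partitionSum-fibonomial : ∀ f g q → f 0 ≋ q → g 0 ≋ q →
      (∀ m n → F (suc m) · f (suc n) + F (suc n) · g (suc m) ≋ q · F (suc m +ℕ suc n)) →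
      ∀ m n → m ! · n ! · partitionSum f g m n ≋ q ^ (m +ℕ n) · (m +ℕ n) !
    partitionSum-fibonomial f g q f₀ g₀ pascal = go
      where
        go : ∀ m n → m ! · n ! · partitionSum f g m n ≋ q ^ (m +ℕ n) · (m +ℕ n) !
        go zero n =
          trans (*-cong (*-identityˡ _) (trans (partitionSum-zeroˡ f g n) (^-congˡ n g₀))) (*-comm _ _)
        go (suc m) zero rewrite ℕ.+-identityʳ m =
          trans (*-cong (*-identityʳ _) (trans (partitionSum-zeroʳ f g (suc m)) (^-congˡ (suc m) f₀))) (*-comm _ _)
        go (suc m) (suc n) = begin
          m ! · p · (n ! · p′) · partitionSum f g (suc m) (suc n)
            ≈⟨ *-congˡ (partitionSum-pascal f g m n) ⟩
          m ! · p · (n ! · p′) · (f (suc n) · partitionSum f g m (suc n) + g (suc m) · partitionSum f g (suc m) n)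
            ≈⟨ solve 8 (λ a b p p′ x y P P′ → a :* p :* (b :* p′) :* (x :* P :+ y :* P′)
                                              := p :* x :* (a :* (b :* p′) :* P) :+ p′ :* y :* (a :* p :* b :* P′))
                 ≋-refl (m !) (n !) p p′ (f (suc n)) (g (suc m)) (partitionSum f g m (suc n)) (partitionSum f g (suc m) n) ⟩
          p · f (suc n) · (m ! · suc n ! · partitionSum f g m (suc n))
            + p′ · g (suc m) · (suc m ! · n ! · partitionSum f g (suc m) n)
            ≈⟨ +-cong (*-congˡ (go m (suc n)))
                      (*-congˡ (trans (go (suc m) n) (reflexive (cong (λ k → q ^ k · k !) (≡.sym (ℕ.+-suc m n)))))) ⟩
          p · f (suc n) · (q ^ N · N !) + p′ · g (suc m) · (q ^ N · N !)
            ≈⟨ sym (distribʳ _ _ _) ⟩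
          (p · f (suc n) + p′ · g (suc m)) · (q ^ N · N !)
            ≈⟨ *-congʳ (pascal m n) ⟩
          q · F (suc N) · (q ^ N · N !)
            ≈⟨ solve 4 (λ q x E X → q :* x :* (E :* X) := q :* E :* (X :* x)) ≋-refl q (F (suc N)) (q ^ N) (N !) ⟩
          q ^ suc N · suc N ! ∎
          where
            p p′ : C
            p = F (suc m)
            p′ = F (suc n)
            N : ℕ
            N = m +ℕ suc n

    ∑-allTuples : ∀ {A : ℕ → Set} (tilings : ∀ ℓ → List (A ℓ)) (w : ∀ {ℓ} → A ℓ → C) μ →
      ∑ (map (wTuple w) (allTuples tilings μ)) ≋ ∏ (totalWeight tilings w) μ
    ∑-allTuples tilings w []      = +-identityʳ 1#
    ∑-allTuples tilings w (ℓ ∷ μ) = begin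
      ∑ (map (wTuple w) (concatMap (λ T → map (T ∷_) (allTuples tilings μ)) (tilings ℓ)))
        ≈⟨ ∑-map-concatMap (wTuple w) (λ T → map (T ∷_) (allTuples tilings μ)) (tilings ℓ) ⟩
      ∑ (map (λ T → ∑ (map (wTuple w) (map (T ∷_) (allTuples tilings μ)))) (tilings ℓ))
        ≈⟨ ∑-map-cong (λ T → trans (∑-map-∘ (wTuple w) (T ∷_) (allTuples tilings μ))
                               (trans (∑-map-*ˡ (w T) (wTuple w) (allTuples tilings μ))
                                      (*-congˡ (∑-allTuples tilings w μ))))
                      (tilings ℓ) ⟩
      ∑ (map (λ T → w T · ∏ (totalWeight tilings w) μ) (tilings ℓ))
        ≈⟨ ∑-map-*ʳ (∏ (totalWeight tilings w) μ) w (tilings ℓ) ⟩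
      ∏ (totalWeight tilings w) (ℓ ∷ μ) ∎

    ∑-tilingsOf : ∀ {A B : ℕ → Set} {m} n (v : Vec ℕ m)
      (rowTilings : ∀ ℓ → List (A ℓ)) (wRow : ∀ {ℓ} → A ℓ → C)
      (colTilings : ∀ ℓ → List (B ℓ)) (wCol : ∀ {ℓ} → B ℓ → C)
      {h : All A (toList v) × All B (toList (dual n v)) → C} →
      (∀ T U → h (T , U) ≋ wTuple wRow T · wTuple wCol U) →
      ∑ (map h (cartesianProduct (allTuples rowTilings (toList v)) (allTuples colTilings (toList (dual n v))))) ≋
      rowWeight (totalWeight rowTilings wRow) v · colWeight (totalWeight colTilings wCol) n v
    ∑-tilingsOf n v rowTilings wRow colTilings wCol h≋ =
      trans (∑-cartesianProduct (wTuple wRow) (wTuple wCol) h≋ (allTuples rowTilings (toList v)) (allTuples colTilings (toList (dual n v))))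
            (*-cong (∑-allTuples rowTilings wRow (toList v)) (∑-allTuples colTilings wCol (toList (dual n v))))

    linearSum≈partitionSum : ∀ m n →
      linearSum R s t m n ≋ partitionSum (totalWeight allL wL) (totalWeight allL' wL) m n
    linearSum≈partitionSum m n = trans (∑-concatMap _ (partitionsIn m n))
      (∑-map-cong (λ v → ∑-tilingsOf n v allL wL allL' wL (λ _ _ → ≋-refl)) (partitionsIn m n))

    circularSum≈partitionSum : ∀ m n →
      circularSum R s t m n ≋ partitionSum (totalWeight allC wC) (totalWeight allC wC) m n
    circularSum≈partitionSum m n = trans (∑-concatMap _ (partitionsIn m n))
      (∑-map-cong (λ v → ∑-tilingsOf n v allC wC allC wC (λ _ _ → ≋-refl)) (partitionsIn m n))

    totalWeight-allL : ∀ ℓ → totalWeight allL wL ℓ ≋ F (suc ℓ)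
    totalWeight-allL zero          = +-identityʳ 1#
    totalWeight-allL (suc zero)    = trans (+-identityʳ _) (sym (trans (+-congˡ (zeroʳ t)) (+-identityʳ _)))
    totalWeight-allL (suc (suc ℓ)) = begin
      ∑ (map wL (map mono (allL (suc ℓ)) ++ map dom (allL ℓ)))
        ≈⟨ ∑-map-++ wL (map mono (allL (suc ℓ))) (map dom (allL ℓ)) ⟩
      ∑ (map wL (map mono (allL (suc ℓ)))) + ∑ (map wL (map dom (allL ℓ)))
        ≈⟨ +-cong (trans (∑-map-∘ wL mono (allL (suc ℓ))) (∑-map-*ˡ s wL (allL (suc ℓ))))
                  (trans (∑-map-∘ wL dom (allL ℓ)) (∑-map-*ˡ t wL (allL ℓ))) ⟩
      s · totalWeight allL wL (suc ℓ) + t · totalWeight allL wL ℓ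
        ≈⟨ +-cong (*-congˡ (totalWeight-allL (suc ℓ))) (*-congˡ (totalWeight-allL ℓ)) ⟩
      F (suc (suc (suc ℓ))) ∎

    totalWeight-allL'-suc : ∀ ℓ → totalWeight allL' wL (suc ℓ) ≋ t · F ℓ
    totalWeight-allL'-suc zero    = sym (zeroʳ t)
    totalWeight-allL'-suc (suc ℓ) = begin
      ∑ (map wL (filterᵇ startsWithDomino (map mono (allL (suc ℓ)) ++ map dom (allL ℓ))))
        ≈⟨ ∑-filterᵇ startsWithDomino wL (map mono (allL (suc ℓ)) ++ map dom (allL ℓ)) ⟩
      ∑ (map h (map mono (allL (suc ℓ)) ++ map dom (allL ℓ)))
        ≈⟨ ∑-map-++ h (map mono (allL (suc ℓ))) (map dom (allL ℓ)) ⟩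
      ∑ (map h (map mono (allL (suc ℓ)))) + ∑ (map h (map dom (allL ℓ)))
        ≈⟨ +-cong (trans (∑-map-∘ h mono (allL (suc ℓ))) (∑-map-0 (allL (suc ℓ))))
                  (trans (∑-map-∘ h dom (allL ℓ)) (∑-map-*ˡ t wL (allL ℓ))) ⟩
      0# + t · totalWeight allL wL ℓ
        ≈⟨ trans (+-identityˡ _) (*-congˡ (totalWeight-allL ℓ)) ⟩
      t · F (suc ℓ) ∎
      where
        startsWithDomino : ∀ {k} → LTiling k → Bool
        startsWithDomino T = notB (startsMono T)

        h : ∀ {k} → LTiling k → C
        h T = when (startsWithDomino T) (wL T)

    totalWeight-allC-suc : ∀ ℓ → totalWeight allC wC (suc ℓ) ≋ F (suc (suc ℓ)) + t · F ℓ
    totalWeight-allC-suc zero    = trans (+-identityʳ _)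
      (sym (trans (+-congʳ (trans (+-congˡ (zeroʳ t)) (+-identityʳ _))) (trans (+-congˡ (zeroʳ t)) (+-identityʳ _))))
    totalWeight-allC-suc (suc ℓ) = begin
      ∑ (map wC (map lin (allL (suc (suc ℓ))) ++ map wrap (allL ℓ)))
        ≈⟨ ∑-map-++ wC (map lin (allL (suc (suc ℓ)))) (map wrap (allL ℓ)) ⟩
      ∑ (map wC (map lin (allL (suc (suc ℓ))))) + ∑ (map wC (map wrap (allL ℓ)))
        ≈⟨ +-cong (trans (∑-map-∘ wC lin (allL (suc (suc ℓ)))) (totalWeight-allL (suc (suc ℓ))))
                  (trans (∑-map-∘ wC wrap (allL ℓ)) (trans (∑-map-*ˡ t wL (allL ℓ)) (*-congˡ (totalWeight-allL ℓ)))) ⟩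
      F (suc (suc (suc ℓ))) + t · F (suc ℓ) ∎

    linearSum-fibonomial : ∀ m n → m ! · n ! · linearSum R s t m n ≋ (m +ℕ n) !
    linearSum-fibonomial m n = begin
      m ! · n ! · linearSum R s t m n
        ≈⟨ *-congˡ (linearSum≈partitionSum m n) ⟩
      m ! · n ! · partitionSum (totalWeight allL wL) (totalWeight allL' wL) m n
        ≈⟨ partitionSum-fibonomial _ _ 1# (+-identityʳ 1#) (+-identityʳ 1#) pascal m n ⟩
      1# ^ (m +ℕ n) · (m +ℕ n) !
        ≈⟨ trans (*-congʳ (^-zeroˡ (m +ℕ n))) (*-identityˡ _) ⟩
      (m +ℕ n) ! ∎
      where
        pascal : ∀ m n → F (suc m) · totalWeight allL wL (suc n) + F (suc n) · totalWeight allL' wL (suc m)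
                         ≋ 1# · F (suc m +ℕ suc n)
        pascal m n = begin
          F (suc m) · totalWeight allL wL (suc n) + F (suc n) · totalWeight allL' wL (suc m)
            ≈⟨ +-cong (*-congˡ (totalWeight-allL (suc n))) (trans (*-congˡ (totalWeight-allL'-suc m)) (*-comm _ _)) ⟩
          F (suc m) · F (suc (suc n)) + t · F m · F (suc n)
            ≈⟨ sym (F-+ m (suc n)) ⟩
          F (suc m +ℕ suc n)
            ≈⟨ sym (*-identityˡ _) ⟩
          1# · F (suc m +ℕ suc n) ∎

    circularSum-fibonomial : ∀ m n →
      m ! · n ! · circularSum R s t m n ≋ pow R s t (two R s t) (m +ℕ n) · (m +ℕ n) !
    circularSum-fibonomial m n = begin
      m ! · n ! · circularSum R s t m n
        ≈⟨ *-congˡ (circularSum≈partitionSum m n) ⟩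
      m ! · n ! · partitionSum (totalWeight allC wC) (totalWeight allC wC) m n
        ≈⟨ partitionSum-fibonomial _ _ (1# + 1#) (+-identityʳ _) (+-identityʳ _) pascal m n ⟩
      (1# + 1#) ^ (m +ℕ n) · (m +ℕ n) !
        ≈⟨ *-congʳ (sym (pow≈^ (1# + 1#) (m +ℕ n))) ⟩
      pow R s t (1# + 1#) (m +ℕ n) · (m +ℕ n) ! ∎
      where
        pascal : ∀ m n → F (suc m) · totalWeight allC wC (suc n) + F (suc n) · totalWeight allC wC (suc m)
                         ≋ (1# + 1#) · F (suc m +ℕ suc n)
        pascal m n = begin
          F (suc m) · totalWeight allC wC (suc n) + F (suc n) · totalWeight allC wC (suc m)
            ≈⟨ +-cong (*-congˡ (totalWeight-allC-suc n)) (*-congˡ (totalWeight-allC-suc m)) ⟩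
          F (suc m) · (F (suc (suc n)) + t · F n) + F (suc n) · (F (suc (suc m)) + t · F m)
            ≈⟨ solve 7 (λ a b a′ b′ t x y → a :* (a′ :+ t :* y) :+ b :* (b′ :+ t :* x)
                                           := (a :* a′ :+ t :* x :* b) :+ (b′ :* b :+ t :* a :* y))
                 ≋-refl (F (suc m)) (F (suc n)) (F (suc (suc n))) (F (suc (suc m))) t (F m) (F n) ⟩
          (F (suc m) · F (suc (suc n)) + t · F m · F (suc n)) + (F (suc (suc m)) · F (suc n) + t · F (suc m) · F n)
            ≈⟨ +-cong (sym (F-+ m (suc n))) (trans (sym (F-+ (suc m) n)) (reflexive (cong (F ∘ suc) (≡.sym (ℕ.+-suc m n))))) ⟩
          F (suc m +ℕ suc n) + F (suc m +ℕ suc n)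
            ≈⟨ sym (trans (distribʳ _ 1# 1#) (+-cong (*-identityˡ _) (*-identityˡ _))) ⟩
          (1# + 1#) · F (suc m +ℕ suc n) ∎

theorem3p1 : {c ℓ : Level} (R : CommutativeSemiring c ℓ) (s t : Carrier R) (m n : ℕ) →
    (_≈_ R (_*_ R (_*_ R (F! R s t m) (F! R s t n)) (linearSum R s t m n)) (F! R s t (m +ℕ n)))
    × (_≈_ R (_*_ R (_*_ R (F! R s t m) (F! R s t n)) (circularSum R s t m n)) (_*_ R (pow R s t (two R s t) (m +ℕ n)) (F! R s t (m +ℕ n))))
theorem3p1 R s t m n = linearSum-fibonomial R s t m n , circularSum-fibonomial R s t m n
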